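{- Let $G$ be a graph of order $n$ and let $D_n$ be a maximal Diophantine graph of order $n$. If $G$ is Diophantine, then $F(G)\le F(D_n)$.
   Context: All graphs are finite, simple and undirected. A graph $G$ with $n$ vertices is Diophantine if there is a bijection $f:V(G)\to\{1,\dots,n\}$ such that $\gcd(f(u),f(v))\mid n$ for every edge $uv$. A maximal Diophantine graph $D_n$ of order $n$ is a Diophantine graph of order $n$ such that adding any new edge yields a non-Diophantine graph. $F(H)$ denotes the number of vertices of a graph $H$ of degree $|V(H)|-1$. -}

module Defs where

open import Data.Nat using (ℕ; suc; _∸_)
open import Data.Nat.Divisibility using (_∣_)
open import Data.Nat.GCD using (gcd)
open import Data.Fin using (Fin; toℕ; _≟_)
open import Data.Bool using (Bool; true; false; _∨_; _∧_; if_then_else_)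
open import Data.List using (List; allFin; length; filterᵇ)
open import Data.Product using (Σ; _×_)
open import Function.Definitions using (Bijective)
open import Relation.Binary.PropositionalEquality using (_≡_; _≢_)
open import Relation.Nullary using (¬_)
open import Relation.Nullary.Decidable using (⌊_⌋)

record Graph (n : ℕ) : Set where
  field
    adj    : Fin n → Fin n → Bool
    sym    : ∀ u v → adj u v ≡ adj v u
    irrefl : ∀ u → adj u u ≡ false
open Graph public

-- Diophantine labeling of an adjacency relation: a bijection
-- f : V → {1,…,n} (encoded as Fin n, label of u is toℕ (f u) + 1)
-- such that gcd (f u) (f v) ∣ n for every edge uv.
DiophantineAdj : {n : ℕ} → (Fin n → Fin n → Bool) → Set
DiophantineAdj {n} a =
  Σ (Fin n → Fin n) λ f →
    Bijective _≡_ _≡_ f ×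
    (∀ u v → a u v ≡ true → gcd (suc (toℕ (f u))) (suc (toℕ (f v))) ∣ n)

IsDiophantine : {n : ℕ} → Graph n → Set
IsDiophantine G = DiophantineAdj (adj G)

addEdge : {n : ℕ} → (Fin n → Fin n → Bool) → Fin n → Fin n → (Fin n → Fin n → Bool)
addEdge a u v i j =
  a i j ∨ ((⌊ i ≟ u ⌋ ∧ ⌊ j ≟ v ⌋) ∨ (⌊ i ≟ v ⌋ ∧ ⌊ j ≟ u ⌋))

IsMaximalDiophantine : {n : ℕ} → Graph n → Set
IsMaximalDiophantine {n} D =
  IsDiophantine D ×
  (∀ (u v : Fin n) → u ≢ v → adj D u v ≡ false → ¬ DiophantineAdj (addEdge (adj D) u v))

degree : {n : ℕ} → Graph n → Fin n → ℕ
degree {n} G u = length (filterᵇ (adj G u) (allFin n))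

F : {n : ℕ} → Graph n → ℕ
F {n} G = length (filterᵇ (λ u → ⌊ Data.Nat._≟_ (degree G u) (n ∸ 1) ⌋) (allFin n))

-- If u is adjacent to every other vertex of G, its label ℓ = f u satisfies gcd(ℓ, k) ∣ n
-- for every other label k, a property of ℓ alone, not of G. In a maximal Diophantine
-- graph D the vertex carrying such a label must be universal, since otherwise the edge
-- to a non-neighbour could be added without breaking the labelling. Matching vertices of
-- G and D with equal labels therefore injects the universal vertices of G into those of D.
module Submission where

open import Defs hiding (sym)
open import Algebra.Properties.CommutativeSemigroup using (x∙yz≈y∙xz)
open import Data.Bool using (Bool; true; false; T; T?; _∧_)
open import Data.Bool.Properties using (T-≡; T-∨; T-∧)
open import Data.Fin using (Fin; zero; suc; toℕ; punchIn; punchOut; _≟_)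
open import Data.Fin.Properties
  using (¬Fin0; 0≢1+n; suc-injective; punchInᵢ≢i; punchIn-punchOut; punchOut-injective)
open import Data.List using (List; _∷_; length; filterᵇ; tabulate; allFin)
open import Data.List.Properties using (length-tabulate; filter-all; filter-notAll)
import Data.List.Relation.Unary.All.Properties as All
import Data.List.Relation.Unary.Any.Properties as Any
open import Data.Nat using (ℕ; zero; suc; _+_; _≤_; _<_; z≤n; s≤s)
open import Data.Nat.Divisibility using (_∣_)
open import Data.Nat.GCD using (gcd; gcd-comm)
open import Data.Nat.Properties using (+-commutativeSemigroup; <-irrefl; module ≤-Reasoning)
  renaming (_≟_ to _≟ℕ_)
open import Data.Product using (Σ; _×_; _,_; proj₁; proj₂)
open import Data.Sum using (_⊎_; inj₁; inj₂)
import Data.Sum as Sum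
import Data.Product as Product
open import Function using (_∘_; id)
open import Function.Bundles using (Equivalence)
open import Function.Definitions using (Injective; Surjective)
open import Relation.Binary.PropositionalEquality
  using (_≡_; _≢_; _≗_; refl; sym; trans; cong; subst; module ≡-Reasoning)
open import Relation.Nullary using (¬_; contradiction)
open import Relation.Nullary.Decidable using (⌊_⌋; toWitness; fromWitness; decidable-stable)

private
  variable
    A B C : Set
    m n : ℕ

bit : Bool → ℕ
bit false = 0
bit true  = 1

count : (Fin n → Bool) → ℕ
count {n} p = length (filterᵇ p (allFin n))

length-filterᵇ-∷ : (p : A → Bool) (x : A) (xs : List A) →
  length (filterᵇ p (x ∷ xs)) ≡ bit (p x) + length (filterᵇ p xs)
length-filterᵇ-∷ p x xs with p x
... | true  = refl
... | false = refl

length-filterᵇ-tabulate : (p : A → Bool) (f : Fin n → A) →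
  length (filterᵇ p (tabulate f)) ≡ count (p ∘ f)
length-filterᵇ-tabulate {n = zero}  p f = refl
length-filterᵇ-tabulate {n = suc n} p f = begin
  length (filterᵇ p (tabulate f))
    ≡⟨ length-filterᵇ-∷ p (f zero) _ ⟩
  b + length (filterᵇ p (tabulate (f ∘ suc)))
    ≡⟨ cong (b +_) (length-filterᵇ-tabulate p (f ∘ suc)) ⟩
  b + count (p ∘ f ∘ suc)
    ≡⟨ cong (b +_) (sym (length-filterᵇ-tabulate (p ∘ f) suc)) ⟩
  b + length (filterᵇ (p ∘ f) (tabulate suc))
    ≡⟨ sym (length-filterᵇ-∷ (p ∘ f) zero _) ⟩
  count (p ∘ f)
    ∎
  where
  open ≡-Reasoning
  b = bit (p (f zero))

count-suc : (p : Fin (suc n) → Bool) → count p ≡ bit (p zero) + count (p ∘ suc)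
count-suc p = trans (length-filterᵇ-∷ p zero _) (cong (bit (p zero) +_) (length-filterᵇ-tabulate p suc))

count-punchIn : (p : Fin (suc n) → Bool) (u : Fin (suc n)) →
  count p ≡ bit (p u) + count (p ∘ punchIn u)
count-punchIn p zero = count-suc p
count-punchIn {n = suc n} p (suc u) = begin
  count p                                  ≡⟨ count-suc p ⟩
  b₀ + count (p ∘ suc)                     ≡⟨ cong (b₀ +_) (count-punchIn (p ∘ suc) u) ⟩
  b₀ + (bᵤ + count (p ∘ suc ∘ punchIn u))  ≡⟨ x∙yz≈y∙xz +-commutativeSemigroup b₀ bᵤ _ ⟩
  bᵤ + (b₀ + count (p ∘ suc ∘ punchIn u))  ≡⟨ cong (bᵤ +_) (sym (count-suc (p ∘ punchIn (suc u)))) ⟩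
  bᵤ + count (p ∘ punchIn (suc u))         ∎
  where
  open ≡-Reasoning
  b₀ = bit (p zero)
  bᵤ = bit (p (suc u))

count-punchIn-true : (p : Fin (suc n) → Bool) (u : Fin (suc n)) → T (p u) →
  count p ≡ suc (count (p ∘ punchIn u))
count-punchIn-true p u pu with p u | count-punchIn p u
... | true | eq = eq

count-all : {p : Fin n → Bool} → (∀ i → T (p i)) → count p ≡ n
count-all {n} {p} all =
  trans (cong length (filter-all (T? ∘ p) (All.tabulate⁺ all))) (length-tabulate {n = n} id)

count-notAll : {p : Fin n → Bool} (i : Fin n) → ¬ T (p i) → count p < n
count-notAll {n} {p} i ¬pi =
  subst (count p <_) (length-tabulate {n = n} id)
    (filter-notAll (T? ∘ p) (allFin n) (Any.tabulate⁺ i ¬pi))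

count≡n⇒all : {p : Fin n → Bool} → count p ≡ n → ∀ i → T (p i)
count≡n⇒all {p = p} eq i = decidable-stable (T? (p i)) (λ ¬pi → <-irrefl eq (count-notAll i ¬pi))

injective⇒count≤ : {p : Fin m → Bool} {q : Fin n → Bool} (h : Fin m → Fin n) →
  Injective _≡_ _≡_ h → (∀ i → T (p i) → T (q (h i))) → count p ≤ count q
injective⇒count≤ {zero}           h h-inj p⇒q = z≤n
injective⇒count≤ {suc m} {zero}   h h-inj p⇒q = contradiction (h zero) ¬Fin0
injective⇒count≤ {suc m} {suc n} {p} {q} h h-inj p⇒q
  rewrite count-suc p with p zero | p⇒q zero
... | false | _        = injective⇒count≤ {q = q} (h ∘ suc) (suc-injective ∘ h-inj) (p⇒q ∘ suc)
... | true  | q[h0] = begin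
  suc (count (p ∘ suc))                  ≤⟨ s≤s (injective⇒count≤ h′ h′-inj p⇒q∘h′) ⟩
  suc (count (q ∘ punchIn (h zero)))     ≡⟨ sym (count-punchIn-true q (h zero) (q[h0] _)) ⟩
  count q                                ∎
  where
  open ≤-Reasoning
  h0≢h[1+i] : ∀ i → h zero ≢ h (suc i)
  h0≢h[1+i] i = 0≢1+n ∘ h-inj
  h′ : Fin m → Fin n
  h′ i = punchOut (h0≢h[1+i] i)
  h′-inj : Injective _≡_ _≡_ h′
  h′-inj {i} {j} = suc-injective ∘ h-inj ∘ punchOut-injective (h0≢h[1+i] i) (h0≢h[1+i] j)
  p⇒q∘h′ : ∀ i → T (p (suc i)) → T (q (punchIn (h zero) (h′ i)))
  p⇒q∘h′ i = subst (T ∘ q) (sym (punchIn-punchOut (h0≢h[1+i] i))) ∘ p⇒q (suc i)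

injectiveLift : {f : A → C} {g : B → C} → Injective _≡_ _≡_ f → Surjective _≡_ _≡_ g →
  Σ (A → B) λ h → Injective _≡_ _≡_ h × g ∘ h ≗ f
injectiveLift {A = A} {B = B} {f = f} {g} f-inj g-surj = h , h-inj , g∘h≗f
  where
  h : A → B
  h a = proj₁ (g-surj (f a))
  g∘h≗f : g ∘ h ≗ f
  g∘h≗f a = proj₂ (g-surj (f a)) refl
  h-inj : Injective _≡_ _≡_ h
  h-inj {a} {a′} e = f-inj (trans (sym (g∘h≗f a)) (trans (cong g e) (g∘h≗f a′)))

Universal : Graph n → Fin n → Set
Universal G u = ∀ v → v ≢ u → T (adj G u v)

degree-punchIn : (G : Graph (suc n)) (u : Fin (suc n)) →
  degree G u ≡ count (adj G u ∘ punchIn u)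
degree-punchIn G u =
  trans (count-punchIn (adj G u) u) (cong (λ b → bit b + count (adj G u ∘ punchIn u)) (irrefl G u))

degree≡n⇒universal : (G : Graph (suc n)) (u : Fin (suc n)) → degree G u ≡ n → Universal G u
degree≡n⇒universal G u deg v v≢u =
  subst (T ∘ adj G u) (punchIn-punchOut u≢v)
    (count≡n⇒all (trans (sym (degree-punchIn G u)) deg) (punchOut u≢v))
  where
  u≢v : u ≢ v
  u≢v = v≢u ∘ sym

universal⇒degree≡n : (G : Graph (suc n)) (u : Fin (suc n)) → Universal G u → degree G u ≡ n
universal⇒degree≡n G u univ =
  trans (degree-punchIn G u) (count-all (λ i → univ (punchIn u i) (punchInᵢ≢i u i)))

Compatible : Fin n → Fin n → Set
Compatible {n} ℓ k = gcd (suc (toℕ ℓ)) (suc (toℕ k)) ∣ n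

compatible-sym : (ℓ k : Fin n) → Compatible ℓ k → Compatible k ℓ
compatible-sym ℓ k = subst (_∣ _) (gcd-comm (suc (toℕ ℓ)) (suc (toℕ k)))

UniversalLabel : Fin n → Set
UniversalLabel ℓ = ∀ k → k ≢ ℓ → Compatible ℓ k

universal⇒universalLabel : (G : Graph n) ((f , _ , _) : IsDiophantine G) (u : Fin n) →
  Universal G u → UniversalLabel (f u)
universal⇒universalLabel G (f , (_ , f-surj) , f-ok) u univ k k≢fu =
  subst (Compatible (f u)) fv≡k (f-ok u v (Equivalence.to T-≡ (univ v v≢u)))
  where
  v = proj₁ (f-surj k)
  fv≡k = proj₂ (f-surj k) refl
  v≢u : v ≢ u
  v≢u v≡u = k≢fu (trans (sym fv≡k) (cong f v≡u))

addEdge-cases : {a : Fin n → Fin n → Bool} {u v i j : Fin n} → T (addEdge a u v i j) →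
  T (a i j) ⊎ (i ≡ u × j ≡ v) ⊎ (i ≡ v × j ≡ u)
addEdge-cases =
  Sum.map₂ (Sum.map bothWitnesses bothWitnesses ∘ Equivalence.to T-∨) ∘ Equivalence.to T-∨
  where
  bothWitnesses : {x y z w : Fin n} → T (⌊ x ≟ y ⌋ ∧ ⌊ z ≟ w ⌋) → x ≡ y × z ≡ w
  bothWitnesses {x = x} {y} {z} {w} =
    Product.map (toWitness {a? = x ≟ y}) (toWitness {a? = z ≟ w}) ∘ Equivalence.to T-∧

compatible-addEdge : {a : Fin n → Fin n → Bool} {f : Fin n → Fin n} {u v : Fin n} →
  (∀ i j → a i j ≡ true → Compatible (f i) (f j)) → Compatible (f u) (f v) →
  ∀ i j → addEdge a u v i j ≡ true → Compatible (f i) (f j)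
compatible-addEdge {a = a} {f} {u} {v} ok uv i j e
  with addEdge-cases {a = a} {u} {v} {i} {j} (Equivalence.from T-≡ e)
... | inj₁ aij                  = ok i j (Equivalence.to T-≡ aij)
... | inj₂ (inj₁ (refl , refl)) = uv
... | inj₂ (inj₂ (refl , refl)) = compatible-sym (f u) (f v) uv

compatible⇒adjacent : (D : Graph n) → IsMaximalDiophantine D → ((f , _ , _) : IsDiophantine D) →
  {u v : Fin n} → u ≢ v → Compatible (f u) (f v) → T (adj D u v)
compatible⇒adjacent D (_ , maximal) (f , f-bij , f-ok) {u} {v} u≢v uv with adj D u v in e
... | true  = _
... | false = maximal u v u≢v e (f , f-bij , compatible-addEdge {a = adj D} {f} {u} {v} f-ok uv)

universalLabel⇒universal : (D : Graph n) → IsMaximalDiophantine D → ((f , _ , _) : IsDiophantine D) →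
  (w : Fin n) → UniversalLabel (f w) → Universal D w
universalLabel⇒universal D max L@(f , (f-inj , _) , _) w univ x x≢w =
  compatible⇒adjacent D max L (x≢w ∘ sym) (univ (f x) (x≢w ∘ f-inj))

corollary3p3 : (n : ℕ) (G D : Graph n) →
    IsMaximalDiophantine D → IsDiophantine G → F G ≤ F D
corollary3p3 zero    G D _ _ = z≤n
corollary3p3 (suc m) G D max@(LD@(fD , (_ , fD-surj) , _) , _) LG@(fG , (fG-inj , _) , _)
  with h , h-inj , fD∘h≗fG ← injectiveLift fG-inj fD-surj =
  injective⇒count≤ {p = hasFullDegree G} {q = hasFullDegree D} h h-inj universal↦universal
  where
  hasFullDegree : Graph (suc m) → Fin (suc m) → Bool
  hasFullDegree H u = ⌊ degree H u ≟ℕ m ⌋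
  universal↦universal : ∀ u → T (hasFullDegree G u) → T (hasFullDegree D (h u))
  universal↦universal u =
    fromWitness ∘ universal⇒degree≡n D (h u)
    ∘ universalLabel⇒universal D max LD (h u) ∘ subst UniversalLabel (sym (fD∘h≗fG u))
    ∘ universal⇒universalLabel G LG u ∘ degree≡n⇒universal G u ∘ toWitness
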